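{- Let $\mathbb{S}$ and $\mathbb{S}'$ be semifields of order $q^n$ with $\mathbb{F}_q$ in their centres, represented on $\mathbb{F}_{q^n}$, and suppose $\mathbb{S}$ and $\mathbb{S}'$ are strongly isotopic. Then $\mathrm{mrk}(\mathbb{S}) = \mathrm{mrk}(\mathbb{S}')$.
   Context: An $n$-dimensional algebra over $\mathbb{F}_q$ is $\mathbb{F}_{q^n}$ with an $\mathbb{F}_q$-bilinear multiplication, which can be written uniquely as $\mathbb{S}(x,y)=\sum_{i,j=0}^{n-1}c_{ij}x^{q^i}y^{q^j}$ with $c_{ij}\in\mathbb{F}_{q^n}$. $M(\mathbb{S})\in M_n(\mathbb{F}_{q^n})$ is the matrix with $(i,j)$-entry $c_{ij}$ (indices $0,\dots,n-1$), and the matrix rank is $\mathrm{mrk}(\mathbb{S})=\mathrm{rank}(M(\mathbb{S}))$ (rank over $\mathbb{F}_{q^n}$). $\mathbb{S}$ and $\mathbb{S}'$ are strongly isotopic if there exist invertible $\mathbb{F}_q$-linear maps $F,G$ of $\mathbb{F}_{q^n}$ with $\mathbb{S}'(F(x),G(y))=\mathbb{S}(x,y)$ for all $x,y$ (isotopy via a triple $(F,G,I)$). -}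

module Defs where

open import Level using (0ℓ)
open import Data.Nat using (ℕ; zero; suc; _^_; _≤_)
open import Data.Fin using (Fin)
open import Data.Product using (Σ; _×_; ∃)
open import Data.Sum using (_⊎_)
open import Relation.Nullary using (¬_)
open import Relation.Binary.PropositionalEquality using (_≡_)
open import Algebra.Structures using (IsCommutativeRing)
open import Function.Bundles using (_↔_)

record FiniteField (q n : ℕ) : Set₁ where
  infixl 6 _+_
  infixl 7 _*_
  field
    Carrier : Set
    _+_ _*_ : Carrier → Carrier → Carrier
    -_      : Carrier → Carrier
    0# 1#   : Carrier
    isCommutativeRing : IsCommutativeRing _≡_ _+_ _*_ -_ 0# 1#
    0≢1     : ¬ (0# ≡ 1#)
    inverse : ∀ x → ¬ (x ≡ 0#) → Σ Carrier λ y → x * y ≡ 1#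
    card    : Carrier ↔ Fin (q ^ n)

  pow : Carrier → ℕ → Carrier
  pow x zero    = 1#
  pow x (suc k) = x * pow x k

  Σ[<_]_ : (m : ℕ) → (Fin m → Carrier) → Carrier
  Σ[< zero  ] f = 0#
  Σ[< suc m ] f = f Fin.zero + Σ[< m ] (λ i → f (Fin.suc i))

  InFq : Carrier → Set
  InFq a = pow a q ≡ a

  frob : ℕ → Carrier → Carrier
  frob i x = pow x (q ^ i)

  Matrix : Set
  Matrix = Fin n → Fin n → Carrier

  -- the bilinear multiplication S(x,y) = Σ_{i,j} c_ij x^{q^i} y^{q^j}
  -- determined by its (unique) coefficient matrix c = M(S)
  mult : Matrix → Carrier → Carrier → Carrier
  mult c x y = Σ[< n ] λ i → Σ[< n ] λ j → c i j * frob (Data.Fin.toℕ i) x * frob (Data.Fin.toℕ j) y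

  -- the multiplication given by c makes F_{q^n} a semifield
  -- (it is automatically F_q-bilinear, so F_q lies in the centre):
  -- it has a two-sided identity and no zero divisors.
  IsSemifield : Matrix → Set
  IsSemifield c =
    (Σ Carrier λ e → ∀ x → (mult c e x ≡ x) × (mult c x e ≡ x))
    × (∀ x y → mult c x y ≡ 0# → (x ≡ 0#) ⊎ (y ≡ 0#))

  IsFqLinearBij : (Carrier → Carrier) → Set
  IsFqLinearBij F =
    (∀ x y → F (x + y) ≡ F x + F y)
    × (∀ a x → InFq a → F (a * x) ≡ a * F x)
    × (Σ (Carrier → Carrier) λ G → (∀ x → G (F x) ≡ x) × (∀ x → F (G x) ≡ x))

  StronglyIsotopic : Matrix → Matrix → Set
  StronglyIsotopic c c' =
    Σ (Carrier → Carrier) λ F → Σ (Carrier → Carrier) λ G →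
      IsFqLinearBij F × IsFqLinearBij G × (∀ x y → mult c' (F x) (G y) ≡ mult c x y)

  LinIndep : (r : ℕ) → (Fin r → Fin n → Carrier) → Set
  LinIndep r v =
    ∀ (λs : Fin r → Carrier) →
      (∀ j → (Σ[< r ] λ k → λs k * v k j) ≡ 0#) → ∀ k → λs k ≡ 0#

  HasIndepRows : Matrix → ℕ → Set
  HasIndepRows M r =
    Σ (Fin r → Fin n) λ ρ →
      (∀ k l → ρ k ≡ ρ l → k ≡ l) × LinIndep r (λ k j → M (ρ k) j)

  HasRank : Matrix → ℕ → Set
  HasRank M r = HasIndepRows M r × ¬ HasIndepRows M (suc r)

module Submission where

-- Write S(x, y) = Σ_i x^(q^i) L_i(y), where L_i(y) = Σ_j c_ij y^(q^j) is the
-- linearised polynomial of the i-th row of M(S).  The rank of M(S) is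
-- characterised intrinsically: M(S) has r independent rows iff there are r
-- points x_1, …, x_r whose slices y ↦ S(x_k, y) are linearly independent
-- functions K → K.  Indeed the slices and the L_i span each other, and rows
-- are independent iff their L_i are (Frobenius powers are independent).
-- Independent slices are visibly transported by a strong isotopy
-- S'(F x, G y) = S(x, y), using the points F x_k (resp. F⁻¹ x_k).

open import Defs
open import Level using (0ℓ)
open import Data.Nat as ℕ using (ℕ; zero; suc)
import Data.Nat.Properties as ℕP
open import Data.Integer as ℤ using (ℤ; -[1+_]; _⊖_)
import Data.Integer.Properties as ℤP
open import Data.Sign as Sign using (Sign)
open import Data.Fin as Fin using (Fin; zero; suc; punchIn; punchOut; toℕ)
import Data.Fin.Properties as FinP
open import Data.Vec as Vec using (Vec; []; _∷_)
import Data.Vec.Properties as VecP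
open import Data.Vec.Functional using (insertAt)
open import Data.Vec.Functional.Properties using (insertAt-lookup; insertAt-punchIn)
open import Data.Unit using (⊤; tt)
open import Data.Bool using (true; false; if_then_else_)
open import Data.Product as Product using (Σ; _×_; _,_; proj₁; proj₂)
open import Data.Sum as Sum using (_⊎_; inj₁; inj₂)
open import Data.Empty using (⊥-elim)
import Data.Maybe as Maybe
open import Relation.Nullary using (¬_; Dec; yes; no; ¬?)
import Relation.Nullary.Decidable as Decidable
open import Relation.Binary.Definitions using (tri<; tri≈; tri>)
open import Relation.Binary.PropositionalEquality
open import Algebra.Bundles using (CommutativeRing)
open import Algebra.Structures using (IsCommutativeRing)
open import Function.Bundles using (Inverse; _⇔_; mk⇔; Equivalence)
import Algebra.Solver.Ring as RingSolver
import Algebra.Solver.Ring.AlmostCommutativeRing as ACR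

module FieldArithmetic {q n : ℕ} (K : FiniteField q n) where
  open FiniteField K public
  open IsCommutativeRing isCommutativeRing public
    using (+-comm; +-identityˡ; +-identityʳ; *-assoc; *-comm;
           *-identityˡ; *-identityʳ; distribˡ; zeroˡ; zeroʳ; -‿inverseʳ)

  commutativeRing : CommutativeRing 0ℓ 0ℓ
  commutativeRing = record { isCommutativeRing = isCommutativeRing }

  open CommutativeRing commutativeRing
    using (ring; semiring; +-group; +-abelianGroup; +-commutativeSemigroup; *-commutativeSemigroup)
  open import Algebra.Properties.Ring ring using (-‿distribˡ-*)
  open import Algebra.Properties.Group +-group
    using () renaming (⁻¹-involutive to -‿involutive; ε⁻¹≈ε to -0#≡0#)
  open import Algebra.Properties.AbelianGroup +-abelianGroup using () renaming (⁻¹-∙-comm to -‿+-comm)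
  open import Algebra.Properties.CommutativeSemigroup +-commutativeSemigroup
    using () renaming (interchange to +-interchange)
  open import Algebra.Properties.CommutativeSemigroup *-commutativeSemigroup
    using () renaming (interchange to *-interchange)
  open import Algebra.Properties.Semiring.Mult.TCOptimised semiring
    using (1+×; ×-homo-+; ×1-homo-*) renaming (_×_ to _·_)

  _≟_ : (x y : Carrier) → Dec (x ≡ y)
  x ≟ y = Decidable.map′ decode (cong (Inverse.to card)) (Inverse.to card x FinP.≟ Inverse.to card y)
    where
    decode : Inverse.to card x ≡ Inverse.to card y → x ≡ y
    decode e = trans (sym (Inverse.strictlyInverseʳ card x))
                 (trans (cong (Inverse.from card) e) (Inverse.strictlyInverseʳ card y))

  -- The canonical ring homomorphism ℤ → K, used as coefficient map of the
  -- ring solver (coefficients must compute, so that x - x normalises to 0).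
  fromℕ : ℕ → Carrier
  fromℕ m = m · 1#

  fromℤ : ℤ → Carrier
  fromℤ (ℤ.+ m)  = fromℕ m
  fromℤ -[1+ m ] = - fromℕ (suc m)

  cancel-1# : ∀ a b → (1# + a) + - (1# + b) ≡ a + - b
  cancel-1# a b = begin
      (1# + a) + - (1# + b)    ≡⟨ cong ((1# + a) +_) (sym (-‿+-comm 1# b)) ⟩
      (1# + a) + (- 1# + - b)  ≡⟨ +-interchange 1# a (- 1#) (- b) ⟩
      (1# + - 1#) + (a + - b)  ≡⟨ cong (_+ (a + - b)) (-‿inverseʳ 1#) ⟩
      0# + (a + - b)           ≡⟨ +-identityˡ _ ⟩
      a + - b                  ∎
    where open ≡-Reasoning

  fromℤ-⊖ : ∀ a b → fromℤ (a ⊖ b) ≡ fromℕ a + - fromℕ b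
  fromℤ-⊖ zero    zero    = sym (-‿inverseʳ 0#)
  fromℤ-⊖ zero    (suc b) = sym (+-identityˡ _)
  fromℤ-⊖ (suc a) zero    = trans (sym (+-identityʳ _)) (cong (fromℕ (suc a) +_) (sym -0#≡0#))
  fromℤ-⊖ (suc a) (suc b) = begin
      fromℤ (suc a ⊖ suc b)              ≡⟨ cong fromℤ (ℤP.[1+m]⊖[1+n]≡m⊖n a b) ⟩
      fromℤ (a ⊖ b)                      ≡⟨ fromℤ-⊖ a b ⟩
      fromℕ a + - fromℕ b                ≡⟨ sym (cancel-1# _ _) ⟩
      (1# + fromℕ a) + - (1# + fromℕ b)  ≡⟨ sym (cong₂ (λ u v → u + - v) (1+× a 1#) (1+× b 1#)) ⟩
      fromℕ (suc a) + - fromℕ (suc b)    ∎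
    where open ≡-Reasoning

  fromℤ-+ : ∀ i j → fromℤ (i ℤ.+ j) ≡ fromℤ i + fromℤ j
  fromℤ-+ (ℤ.+ a)  (ℤ.+ b)  = ×-homo-+ 1# a b
  fromℤ-+ (ℤ.+ a)  -[1+ b ] = fromℤ-⊖ a (suc b)
  fromℤ-+ -[1+ a ] (ℤ.+ b)  = trans (fromℤ-⊖ b (suc a)) (+-comm _ _)
  fromℤ-+ -[1+ a ] -[1+ b ] = begin
      - fromℕ (suc (suc (a ℕ.+ b)))     ≡⟨ cong (λ z → - fromℕ z) (sym (ℕP.+-suc (suc a) b)) ⟩
      - fromℕ (suc a ℕ.+ suc b)         ≡⟨ cong -_ (×-homo-+ 1# (suc a) (suc b)) ⟩
      - (fromℕ (suc a) + fromℕ (suc b)) ≡⟨ sym (-‿+-comm _ _) ⟩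
      - fromℕ (suc a) + - fromℕ (suc b) ∎
    where open ≡-Reasoning

  fromSign : Sign → Carrier
  fromSign Sign.+ = 1#
  fromSign Sign.- = - 1#

  -‿as-* : ∀ x → - x ≡ - 1# * x
  -‿as-* x = trans (cong -_ (sym (*-identityˡ x))) (-‿distribˡ-* 1# x)

  fromℤ-◃ : ∀ s k → fromℤ (s ℤ.◃ k) ≡ fromSign s * fromℕ k
  fromℤ-◃ s       zero    = sym (zeroʳ _)
  fromℤ-◃ Sign.+  (suc k) = sym (*-identityˡ _)
  fromℤ-◃ Sign.-  (suc k) = -‿as-* _

  fromℤ-signAbs : ∀ i → fromℤ i ≡ fromSign (ℤ.sign i) * fromℕ ℤ.∣ i ∣
  fromℤ-signAbs (ℤ.+ m)  = sym (*-identityˡ _)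
  fromℤ-signAbs -[1+ m ] = -‿as-* _

  fromSign-* : ∀ s t → fromSign (s Sign.* t) ≡ fromSign s * fromSign t
  fromSign-* Sign.+ Sign.+ = sym (*-identityˡ _)
  fromSign-* Sign.+ Sign.- = sym (*-identityˡ _)
  fromSign-* Sign.- Sign.+ = sym (*-identityʳ _)
  fromSign-* Sign.- Sign.- = trans (sym (-‿involutive 1#)) (-‿as-* (- 1#))

  fromℤ-* : ∀ i j → fromℤ (i ℤ.* j) ≡ fromℤ i * fromℤ j
  fromℤ-* i j = begin
      fromℤ (i ℤ.* j)
        ≡⟨ fromℤ-◃ (ℤ.sign i Sign.* ℤ.sign j) (ℤ.∣ i ∣ ℕ.* ℤ.∣ j ∣) ⟩
      fromSign (ℤ.sign i Sign.* ℤ.sign j) * fromℕ (ℤ.∣ i ∣ ℕ.* ℤ.∣ j ∣)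
        ≡⟨ cong₂ _*_ (fromSign-* (ℤ.sign i) (ℤ.sign j)) (×1-homo-* ℤ.∣ i ∣ ℤ.∣ j ∣) ⟩
      (fromSign (ℤ.sign i) * fromSign (ℤ.sign j)) * (fromℕ ℤ.∣ i ∣ * fromℕ ℤ.∣ j ∣)
        ≡⟨ *-interchange _ _ _ _ ⟩
      (fromSign (ℤ.sign i) * fromℕ ℤ.∣ i ∣) * (fromSign (ℤ.sign j) * fromℕ ℤ.∣ j ∣)
        ≡⟨ sym (cong₂ _*_ (fromℤ-signAbs i) (fromℤ-signAbs j)) ⟩
      fromℤ i * fromℤ j ∎
    where open ≡-Reasoning

  fromℤ-neg : ∀ i → fromℤ (ℤ.- i) ≡ - fromℤ i
  fromℤ-neg (ℤ.+ zero)  = sym -0#≡0#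
  fromℤ-neg (ℤ.+ suc m) = refl
  fromℤ-neg -[1+ m ]    = sym (-‿involutive _)

  fromℤ-homomorphism : ACR._-Raw-AlmostCommutative⟶_
    (CommutativeRing.rawRing ℤP.+-*-commutativeRing) (ACR.fromCommutativeRing commutativeRing)
  fromℤ-homomorphism = record
    { ⟦_⟧ = fromℤ ; +-homo = fromℤ-+ ; *-homo = fromℤ-* ; -‿homo = fromℤ-neg
    ; 0-homo = refl ; 1-homo = refl }

  module Solver = RingSolver (CommutativeRing.rawRing ℤP.+-*-commutativeRing)
    (ACR.fromCommutativeRing commutativeRing) fromℤ-homomorphism
    (λ a b → Maybe.map (cong fromℤ) (Decidable.dec⇒maybe (a ℤ.≟ b)))
  open Solver public using (solve; _:+_; _:*_; :-_; _:=_; con)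

  :0 :1 : ∀ {k} → Solver.Polynomial k
  :0 = con (ℤ.+ 0)
  :1 = con (ℤ.+ 1)

  inv : (x : Carrier) → ¬ (x ≡ 0#) → Carrier
  inv x x≢0 = proj₁ (inverse x x≢0)

  inv-l : ∀ x (x≢0 : ¬ (x ≡ 0#)) → inv x x≢0 * x ≡ 1#
  inv-l x x≢0 = trans (*-comm _ _) (proj₂ (inverse x x≢0))

  cancel-nonzero : ∀ x y → x * y ≡ 0# → ¬ (x ≡ 0#) → y ≡ 0#
  cancel-nonzero x y xy≡0 x≢0 = begin
      y                      ≡⟨ sym (*-identityˡ y) ⟩
      1# * y                 ≡⟨ cong (_* y) (sym (inv-l x x≢0)) ⟩
      (inv x x≢0 * x) * y    ≡⟨ *-assoc _ _ _ ⟩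
      inv x x≢0 * (x * y)    ≡⟨ cong (inv x x≢0 *_) xy≡0 ⟩
      inv x x≢0 * 0#         ≡⟨ zeroʳ _ ⟩
      0#                     ∎
    where open ≡-Reasoning

  1≢0 : ¬ (1# ≡ 0#)
  1≢0 e = 0≢1 (sym e)

  difference≡0 : ∀ x y → x + - y ≡ 0# → x ≡ y
  difference≡0 x y x-y≡0 = begin
      x              ≡⟨ solve 2 (λ x y → x := (x :+ :- y) :+ y) refl x y ⟩
      (x + - y) + y  ≡⟨ cong (_+ y) x-y≡0 ⟩
      0# + y         ≡⟨ +-identityˡ y ⟩
      y              ∎
    where open ≡-Reasoning

module Sums {q n : ℕ} (K : FiniteField q n) where
  open FieldArithmetic K

  Σ-cong : ∀ {m} {f g : Fin m → Carrier} → (∀ i → f i ≡ g i) → Σ[< m ] f ≡ Σ[< m ] g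
  Σ-cong {zero}  f≗g = refl
  Σ-cong {suc m} f≗g = cong₂ _+_ (f≗g zero) (Σ-cong (λ i → f≗g (suc i)))

  Σ-vanish : ∀ {m} {f : Fin m → Carrier} → (∀ i → f i ≡ 0#) → Σ[< m ] f ≡ 0#
  Σ-vanish {zero}  f≗0 = refl
  Σ-vanish {suc m} f≗0 = trans (cong₂ _+_ (f≗0 zero) (Σ-vanish (λ i → f≗0 (suc i)))) (+-identityˡ 0#)

  Σ-+ : ∀ {m} (f g : Fin m → Carrier) → Σ[< m ] (λ i → f i + g i) ≡ Σ[< m ] f + Σ[< m ] g
  Σ-+ {zero}  f g = sym (+-identityˡ 0#)
  Σ-+ {suc m} f g = trans (cong ((f zero + g zero) +_) (Σ-+ (λ i → f (suc i)) (λ i → g (suc i))))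
     (solve 4 (λ a b c d → (a :+ b) :+ (c :+ d) := (a :+ c) :+ (b :+ d)) refl _ _ _ _)

  Σ-*ˡ : ∀ {m} a (f : Fin m → Carrier) → a * Σ[< m ] f ≡ Σ[< m ] (λ i → a * f i)
  Σ-*ˡ {zero}  a f = zeroʳ a
  Σ-*ˡ {suc m} a f = trans (distribˡ a _ _) (cong (a * f zero +_) (Σ-*ˡ a (λ i → f (suc i))))

  Σ-*ʳ : ∀ {m} a (f : Fin m → Carrier) → Σ[< m ] f * a ≡ Σ[< m ] (λ i → f i * a)
  Σ-*ʳ {m} a f = trans (*-comm _ a) (trans (Σ-*ˡ a f) (Σ-cong {m} (λ i → *-comm a _)))

  Σ-sub : ∀ {m} (f g : Fin m → Carrier) → Σ[< m ] (λ i → f i + - g i) ≡ Σ[< m ] f + - Σ[< m ] g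
  Σ-sub {m} f g = trans (Σ-+ f (λ i → - g i)) (cong (Σ[< _ ] f +_) (sym Σ-neg))
    where
    Σ-neg : - Σ[< _ ] g ≡ Σ[< _ ] (λ i → - g i)
    Σ-neg = trans (-‿as-* _) (trans (Σ-*ˡ (- 1#) g) (Σ-cong {m} (λ i → sym (-‿as-* _))))

  Σ-swap : ∀ {m k} (f : Fin m → Fin k → Carrier) →
    Σ[< m ] (λ i → Σ[< k ] (λ j → f i j)) ≡ Σ[< k ] (λ j → Σ[< m ] (λ i → f i j))
  Σ-swap {zero}  {k} f = sym (Σ-vanish {k} (λ _ → refl))
  Σ-swap {suc m} {k} f = trans (cong (Σ[< k ] (f zero) +_) (Σ-swap (λ i → f (suc i))))
     (sym (Σ-+ (f zero) (λ j → Σ[< m ] (λ i → f (suc i) j))))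

  Σ-exchange : ∀ {r s} (a : Fin r → Carrier) (b : Fin s → Carrier) (x : Fin r → Fin s → Carrier) →
    Σ[< r ] (λ i → a i * Σ[< s ] (λ t → b t * x i t)) ≡ Σ[< s ] (λ t → b t * Σ[< r ] (λ i → a i * x i t))
  Σ-exchange {r} {s} a b x = begin
      Σ[< r ] (λ i → a i * Σ[< s ] (λ t → b t * x i t))
        ≡⟨ Σ-cong (λ i → Σ-*ˡ (a i) (λ t → b t * x i t)) ⟩
      Σ[< r ] (λ i → Σ[< s ] (λ t → a i * (b t * x i t)))
        ≡⟨ Σ-swap (λ i t → a i * (b t * x i t)) ⟩
      Σ[< s ] (λ t → Σ[< r ] (λ i → a i * (b t * x i t)))
        ≡⟨ Σ-cong (λ t → Σ-cong (λ i → solve 3 (λ a b x → a :* (b :* x) := b :* (a :* x)) refl (a i) (b t) (x i t))) ⟩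
      Σ[< s ] (λ t → Σ[< r ] (λ i → b t * (a i * x i t)))
        ≡⟨ Σ-cong (λ t → sym (Σ-*ˡ (b t) (λ i → a i * x i t))) ⟩
      Σ[< s ] (λ t → b t * Σ[< r ] (λ i → a i * x i t)) ∎
    where open ≡-Reasoning

  Σ-split : ∀ {m} (k : Fin (suc m)) (f : Fin (suc m) → Carrier) →
    Σ[< suc m ] f ≡ f k + Σ[< m ] (λ s → f (punchIn k s))
  Σ-split zero f = refl
  Σ-split {suc m} (suc k) f = trans (cong (f zero +_) (Σ-split k (λ i → f (suc i))))
     (solve 3 (λ a b c → a :+ (b :+ c) := b :+ (a :+ c)) refl _ _ _)

  δ : ∀ {m} → Fin m → Fin m → Carrier
  δ zero    zero    = 1#
  δ zero    (suc j) = 0#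
  δ (suc i) zero    = 0#
  δ (suc i) (suc j) = δ i j

  Σ-δ : ∀ {m} (k : Fin m) (f : Fin m → Carrier) → Σ[< m ] (λ j → δ k j * f j) ≡ f k
  Σ-δ {suc m} zero f = trans (cong₂ _+_ (*-identityˡ _) (Σ-vanish {m} (λ i → zeroˡ _))) (+-identityʳ _)
  Σ-δ {suc m} (suc k) f = trans (cong₂ _+_ (zeroˡ _) (Σ-δ k (λ i → f (suc i)))) (+-identityˡ _)

  δ-refl : ∀ {m} (k : Fin m) → δ k k ≡ 1#
  δ-refl zero    = refl
  δ-refl (suc k) = δ-refl k

  δ-≢ : ∀ {m} (i j : Fin m) → ¬ (i ≡ j) → δ i j ≡ 0#
  δ-≢ zero    zero    i≢j = ⊥-elim (i≢j refl)
  δ-≢ zero    (suc j) i≢j = refl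
  δ-≢ (suc i) zero    i≢j = refl
  δ-≢ (suc i) (suc j) i≢j = δ-≢ i j (λ e → i≢j (cong suc e))

-- Gaussian elimination.

module Elimination {q n : ℕ} (K : FiniteField q n) where
  open FieldArithmetic K
  open Sums K

  NotAllZero : ∀ {r} → (Fin r → Carrier) → Set
  NotAllZero {r} ls = Σ (Fin r) λ k → ¬ (ls k ≡ 0#)

  Annihilated : ∀ m N → (Fin N → Fin m → Carrier) → Set
  Annihilated m N u =
    Σ (Fin m → Carrier) λ ls → NotAllZero ls × (∀ t → Σ[< m ] (λ i → ls i * u t i) ≡ 0#)

  Spans : ∀ m N → (Fin N → Fin m → Carrier) → Set
  Spans m N u = ∀ (v : Fin m → Carrier) →
    Σ (Fin N → Carrier) λ μ → ∀ i → Σ[< N ] (λ t → μ t * u t i) ≡ v i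

  -- One pivot step: the t₀-th vector has nonzero first coordinate a, and the
  -- other vectors are reduced to K^m by clearing their first coordinate with
  -- a multiple of it.
  module PivotStep {m N : ℕ} (u : Fin (suc N) → Fin (suc m) → Carrier)
                   (t₀ : Fin (suc N)) (a≢0 : ¬ (u t₀ zero ≡ 0#)) where
    a a⁻¹ : Carrier
    a   = u t₀ zero
    a⁻¹ = inv a a≢0

    others : Fin N → Fin (suc N)
    others = punchIn t₀

    factor : Fin N → Carrier
    factor s = u (others s) zero * a⁻¹

    reduced : Fin N → Fin m → Carrier
    reduced s i = u (others s) (suc i) + - (factor s * u t₀ (suc i))

    byCases : (P : Fin (suc N) → Set) → P t₀ → (∀ s → P (others s)) → ∀ t → P t
    byCases P p₀ pₛ t with t₀ FinP.≟ t
    ... | yes refl = p₀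
    ... | no t₀≢t  = subst P (FinP.punchIn-punchOut t₀≢t) (pₛ (punchOut t₀≢t))

    -- An annihilator l' of the reduced vectors extends, with first coordinate
    -- -(Σ l'_i u_{t₀,i+1}) a⁻¹, to an annihilator of u.
    liftAnnihilator : Annihilated m N reduced → Annihilated (suc m) (suc N) u
    liftAnnihilator (l' , (k , l'k≢0) , l'⊥reduced) = ls , (suc k , l'k≢0) , byCases P kills-t₀ kills-others
      where
      S₀ : Carrier
      S₀ = Σ[< m ] (λ i → l' i * u t₀ (suc i))
      ls : Fin (suc m) → Carrier
      ls zero    = - (S₀ * a⁻¹)
      ls (suc i) = l' i
      P : Fin (suc N) → Set
      P t = Σ[< suc m ] (λ i → ls i * u t i) ≡ 0#
      kills-t₀ : P t₀
      kills-t₀ = begin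
          - (S₀ * a⁻¹) * a + S₀  ≡⟨ solve 3 (λ S ai a → (:- (S :* ai)) :* a :+ S := S :+ :- (S :* (ai :* a))) refl S₀ a⁻¹ a ⟩
          S₀ + - (S₀ * (a⁻¹ * a)) ≡⟨ cong (λ z → S₀ + - (S₀ * z)) (inv-l a a≢0) ⟩
          S₀ + - (S₀ * 1#)       ≡⟨ cong (λ z → S₀ + - z) (*-identityʳ S₀) ⟩
          S₀ + - S₀              ≡⟨ -‿inverseʳ S₀ ⟩
          0#                     ∎
        where open ≡-Reasoning
      kills-others : ∀ s → P (others s)
      kills-others s = begin
          - (S₀ * a⁻¹) * u (others s) zero + B
            ≡⟨ solve 4 (λ S ai x B → :- (S :* ai) :* x :+ B := B :+ :- ((x :* ai) :* S)) refl S₀ a⁻¹ (u (others s) zero) B ⟩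
          B + - (factor s * S₀)
            ≡⟨ cong (λ z → B + - z) (Σ-*ˡ (factor s) (λ i → l' i * u t₀ (suc i))) ⟩
          B + - Σ[< m ] (λ i → factor s * (l' i * u t₀ (suc i)))
            ≡⟨ sym (Σ-sub (λ i → l' i * u (others s) (suc i)) (λ i → factor s * (l' i * u t₀ (suc i)))) ⟩
          Σ[< m ] (λ i → l' i * u (others s) (suc i) + - (factor s * (l' i * u t₀ (suc i))))
            ≡⟨ Σ-cong (λ i → solve 4 (λ l x c w → l :* x :+ :- (c :* (l :* w)) := l :* (x :+ :- (c :* w))) refl
                                      (l' i) (u (others s) (suc i)) (factor s) (u t₀ (suc i))) ⟩
          Σ[< m ] (λ i → l' i * reduced s i)
            ≡⟨ l'⊥reduced s ⟩
          0# ∎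
        where
        open ≡-Reasoning
        B : Carrier
        B = Σ[< m ] (λ i → l' i * u (others s) (suc i))

    -- If the reduced vectors span K^m then u spans K^(m+1): to reach v, first
    -- reach the correction v' of its tail, then fix the first coordinate
    -- with the pivot vector.
    liftSpanning : Spans m N reduced → Spans (suc m) (suc N) u
    liftSpanning spans v = μ , coordinate
      where
      v' : Fin m → Carrier
      v' i = v (suc i) + - ((v zero * a⁻¹) * u t₀ (suc i))
      μ' : Fin N → Carrier
      μ' = proj₁ (spans v')
      T₀ : Carrier
      T₀ = Σ[< N ] (λ s → μ' s * u (others s) zero)
      μ : Fin (suc N) → Carrier
      μ = insertAt μ' t₀ ((v zero + - T₀) * a⁻¹)

      split : ∀ i → Σ[< suc N ] (λ t → μ t * u t i)
                  ≡ ((v zero + - T₀) * a⁻¹) * u t₀ i + Σ[< N ] (λ s → μ' s * u (others s) i)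
      split i = trans (Σ-split t₀ (λ t → μ t * u t i))
                  (cong₂ _+_ (cong (_* u t₀ i) (insertAt-lookup μ' t₀ _))
                             (Σ-cong (λ s → cong (_* u (others s) i) (insertAt-punchIn μ' t₀ _ s))))

      w B : Fin m → Carrier
      w i = u t₀ (suc i)
      B i = Σ[< N ] (λ s → μ' s * u (others s) (suc i))

      tail-equation : ∀ i → B i + - ((T₀ * a⁻¹) * w i) ≡ v (suc i) + - ((v zero * a⁻¹) * w i)
      tail-equation i = begin
          B i + - ((T₀ * a⁻¹) * w i)
            ≡⟨ cong (λ z → B i + - (z * w i)) (Σ-*ʳ a⁻¹ (λ s → μ' s * u (others s) zero)) ⟩
          B i + - (Σ[< N ] (λ s → μ' s * u (others s) zero * a⁻¹) * w i)
            ≡⟨ cong (λ z → B i + - z) (Σ-*ʳ (w i) (λ s → μ' s * u (others s) zero * a⁻¹)) ⟩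
          B i + - Σ[< N ] (λ s → μ' s * u (others s) zero * a⁻¹ * w i)
            ≡⟨ sym (Σ-sub (λ s → μ' s * u (others s) (suc i)) (λ s → μ' s * u (others s) zero * a⁻¹ * w i)) ⟩
          Σ[< N ] (λ s → μ' s * u (others s) (suc i) + - (μ' s * u (others s) zero * a⁻¹ * w i))
            ≡⟨ Σ-cong (λ s → solve 5 (λ l x y ai w → l :* x :+ :- (l :* y :* ai :* w) := l :* (x :+ :- ((y :* ai) :* w))) refl
                                      (μ' s) (u (others s) (suc i)) (u (others s) zero) a⁻¹ (w i)) ⟩
          Σ[< N ] (λ s → μ' s * reduced s i)
            ≡⟨ proj₂ (spans v') i ⟩
          v (suc i) + - ((v zero * a⁻¹) * w i) ∎
        where open ≡-Reasoning

      coordinate : ∀ i → Σ[< suc N ] (λ t → μ t * u t i) ≡ v i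
      coordinate zero = begin
          Σ[< suc N ] (λ t → μ t * u t zero)  ≡⟨ split zero ⟩
          ((v zero + - T₀) * a⁻¹) * a + T₀    ≡⟨ solve 4 (λ x y ai a → ((x :+ :- y) :* ai) :* a :+ y := (x :+ :- y) :* (ai :* a) :+ y) refl (v zero) T₀ a⁻¹ a ⟩
          (v zero + - T₀) * (a⁻¹ * a) + T₀    ≡⟨ cong (λ z → (v zero + - T₀) * z + T₀) (inv-l a a≢0) ⟩
          (v zero + - T₀) * 1# + T₀           ≡⟨ solve 2 (λ x y → (x :+ :- y) :* :1 :+ y := x) refl (v zero) T₀ ⟩
          v zero ∎
        where open ≡-Reasoning
      coordinate (suc i) = begin
          Σ[< suc N ] (λ t → μ t * u t (suc i))    ≡⟨ split (suc i) ⟩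
          ((v zero + - T₀) * a⁻¹) * w i + B i
            ≡⟨ solve 5 (λ B T ai w x → ((x :+ :- T) :* ai) :* w :+ B := (x :* ai) :* w :+ (B :+ :- ((T :* ai) :* w))) refl (B i) T₀ a⁻¹ (w i) (v zero) ⟩
          (v zero * a⁻¹) * w i + (B i + - ((T₀ * a⁻¹) * w i))
            ≡⟨ cong ((v zero * a⁻¹) * w i +_) (tail-equation i) ⟩
          (v zero * a⁻¹) * w i + (v (suc i) + - ((v zero * a⁻¹) * w i))
            ≡⟨ solve 2 (λ x y → x :+ (y :+ :- x) := y) refl ((v zero * a⁻¹) * w i) (v (suc i)) ⟩
          v (suc i) ∎
        where open ≡-Reasoning

  eliminate : ∀ m N (u : Fin N → Fin m → Carrier) → Annihilated m N u ⊎ (m ℕ.≤ N × Spans m N u)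
  eliminate zero    N       u = inj₂ (ℕ.z≤n , λ v → (λ _ → 0#) , λ ())
  eliminate (suc m) zero    u = inj₁ (δ zero , (zero , 1≢0) , λ ())
  eliminate (suc m) (suc N) u with FinP.any? (λ t → ¬? (u t zero ≟ 0#))
  ... | yes (t₀ , a≢0) =
    Sum.map liftAnnihilator (Product.map ℕ.s≤s liftSpanning) (eliminate m N reduced)
    where open PivotStep u t₀ a≢0
  ... | no noPivot = inj₁ (δ zero , (zero , 1≢0) , λ t → trans (Σ-δ zero (u t)) (firstCoordinate≡0 t))
    where
    firstCoordinate≡0 : ∀ t → u t zero ≡ 0#
    firstCoordinate≡0 t = Decidable.decidable-stable (u t zero ≟ 0#) (λ ne → noPivot (t , ne))

-- Linear algebra of finite families of functions D → K.

module Families {q n : ℕ} (K : FiniteField q n) {D : Set} where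
  open FieldArithmetic K
  open Sums K
  open Elimination K

  Family : ℕ → Set
  Family r = Fin r → D → Carrier

  combination : ∀ r → (Fin r → Carrier) → Family r → D → Carrier
  combination r ls u d = Σ[< r ] (λ k → ls k * u k d)

  Independent : ∀ r → Family r → Set
  Independent r u = ∀ ls → (∀ d → combination r ls u d ≡ 0#) → ∀ k → ls k ≡ 0#

  Dependent : ∀ r → Family r → Set
  Dependent r u = Σ (Fin r → Carrier) λ ls → NotAllZero ls × (∀ d → combination r ls u d ≡ 0#)

  InSpan : ∀ m → Family m → (D → Carrier) → Set
  InSpan m v w = Σ (Fin m → Carrier) λ μ → ∀ d → combination m μ v d ≡ w d

  -- Exchange lemma: r independent functions in the span of s functions force r ≤ s.
  -- (Otherwise the r coordinate vectors in K^s are dependent, and so are the functions.)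
  independent≤spanning : ∀ r s (w : Family r) (b : Family s) →
    Independent r w → (∀ k → InSpan s b (w k)) → r ℕ.≤ s
  independent≤spanning r s w b w-independent w∈span
    with eliminate r s (λ j k → proj₁ (w∈span k) j)
  ... | inj₂ (r≤s , _) = r≤s
  ... | inj₁ (ls , (k , lsk≢0) , ls⊥coordinates) = ⊥-elim (lsk≢0 (w-independent ls relation k))
    where
    coordinate : Fin r → Fin s → Carrier
    coordinate k = proj₁ (w∈span k)
    relation : ∀ d → combination r ls w d ≡ 0#
    relation d = begin
        Σ[< r ] (λ k → ls k * w k d)
          ≡⟨ Σ-cong {r} (λ k → cong (ls k *_) (sym (proj₂ (w∈span k) d))) ⟩
        Σ[< r ] (λ k → ls k * Σ[< s ] (λ j → coordinate k j * b j d))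
          ≡⟨ Σ-cong {r} (λ k → cong (ls k *_) (Σ-cong {s} (λ j → *-comm _ _))) ⟩
        Σ[< r ] (λ k → ls k * Σ[< s ] (λ j → b j d * coordinate k j))
          ≡⟨ Σ-exchange ls (λ j → b j d) coordinate ⟩
        Σ[< s ] (λ j → b j d * Σ[< r ] (λ k → ls k * coordinate k j))
          ≡⟨ Σ-vanish {s} (λ j → trans (cong (b j d *_) (ls⊥coordinates j)) (zeroʳ _)) ⟩
        0# ∎
      where open ≡-Reasoning

  InSpan-trans : ∀ m s (v : Family m) (b : Family s) (w : D → Carrier) →
    InSpan m v w → (∀ i → InSpan s b (v i)) → InSpan s b w
  InSpan-trans m s v b w (μ , μ-combines) v∈span = coefficient , combines
    where
    coordinate : Fin m → Fin s → Carrier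
    coordinate i = proj₁ (v∈span i)
    coefficient : Fin s → Carrier
    coefficient j = Σ[< m ] (λ i → μ i * coordinate i j)
    combines : ∀ d → combination s coefficient b d ≡ w d
    combines d = begin
        Σ[< s ] (λ j → coefficient j * b j d)
          ≡⟨ Σ-cong {s} (λ j → *-comm _ _) ⟩
        Σ[< s ] (λ j → b j d * Σ[< m ] (λ i → μ i * coordinate i j))
          ≡⟨ sym (Σ-exchange μ (λ j → b j d) coordinate) ⟩
        Σ[< m ] (λ i → μ i * Σ[< s ] (λ j → b j d * coordinate i j))
          ≡⟨ Σ-cong {m} (λ i → cong (μ i *_) (trans (Σ-cong {s} (λ j → *-comm _ _)) (proj₂ (v∈span i) d))) ⟩
        Σ[< m ] (λ i → μ i * v i d)
          ≡⟨ μ-combines d ⟩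
        w d ∎
      where open ≡-Reasoning

  -- Subfamilies (taken at distinct indices) of independent families are independent:
  -- a relation among the b (ι k) is a relation among the b j with coefficients
  -- supported on the image of ι.
  subfamily-independent : ∀ r s (b : Family s) (ι : Fin r → Fin s) →
    (∀ x y → ι x ≡ ι y → x ≡ y) → Independent s b → Independent r (λ k → b (ι k))
  subfamily-independent r s b ι ι-injective b-independent ls relation k₀ = begin
      ls k₀                            ≡⟨ sym (Σ-δ k₀ ls) ⟩
      Σ[< r ] (λ k → δ k₀ k * ls k)    ≡⟨ Σ-cong {r} (λ k → trans (*-comm _ _) (cong (ls k *_) (δ-transport k))) ⟩
      pushforward (ι k₀)               ≡⟨ b-independent pushforward pushed-relation (ι k₀) ⟩
      0#                               ∎
    where
    open ≡-Reasoning
    pushforward : Fin s → Carrier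
    pushforward j = Σ[< r ] (λ k → ls k * δ (ι k) j)
    δ-transport : ∀ k → δ k₀ k ≡ δ (ι k) (ι k₀)
    δ-transport k with k FinP.≟ k₀
    ... | yes refl = trans (δ-refl k) (sym (δ-refl (ι k)))
    ... | no k≢k₀  = trans (δ-≢ k₀ k (λ e → k≢k₀ (sym e))) (sym (δ-≢ _ _ (λ e → k≢k₀ (ι-injective _ _ e))))
    pushed-relation : ∀ d → combination s pushforward b d ≡ 0#
    pushed-relation d = begin
        Σ[< s ] (λ j → pushforward j * b j d)
          ≡⟨ Σ-cong {s} (λ j → trans (Σ-*ʳ (b j d) (λ k → ls k * δ (ι k) j)) (Σ-cong {r} (λ k → *-assoc _ _ _))) ⟩
        Σ[< s ] (λ j → Σ[< r ] (λ k → ls k * (δ (ι k) j * b j d)))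
          ≡⟨ sym (Σ-swap (λ k j → ls k * (δ (ι k) j * b j d))) ⟩
        Σ[< r ] (λ k → Σ[< s ] (λ j → ls k * (δ (ι k) j * b j d)))
          ≡⟨ Σ-cong {r} (λ k → trans (sym (Σ-*ˡ (ls k) (λ j → δ (ι k) j * b j d))) (cong (ls k *_) (Σ-δ (ι k) (λ j → b j d)))) ⟩
        Σ[< r ] (λ k → ls k * b (ι k) d)
          ≡⟨ relation d ⟩
        0# ∎

  -- If u is dependent but its tail is independent, then the head lies in the
  -- span of the tail (its coefficient in the relation cannot vanish).
  dependent⇒head∈span : ∀ s (u : Family (suc s)) → Independent s (λ k → u (suc k)) →
    Dependent (suc s) u → InSpan s (λ k → u (suc k)) (u zero)
  dependent⇒head∈span s u tail-independent (ls , (k , lsk≢0) , relation) =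
    (λ k → (- l⁻¹) * ls (suc k)) , combines
    where
    tail : D → Carrier
    tail d = Σ[< s ] (λ k → ls (suc k) * u (suc k) d)
    head≢0 : ¬ (ls zero ≡ 0#)
    head≢0 ls₀≡0 = lsk≢0 (all-zero k)
      where
      tail-relation : ∀ d → tail d ≡ 0#
      tail-relation d = trans (sym (trans (cong (_+ tail d) (trans (cong (_* u zero d) ls₀≡0) (zeroˡ _))) (+-identityˡ _)))
                              (relation d)
      all-zero : ∀ k → ls k ≡ 0#
      all-zero zero    = ls₀≡0
      all-zero (suc j) = tail-independent (λ k → ls (suc k)) tail-relation j
    l⁻¹ : Carrier
    l⁻¹ = inv (ls zero) head≢0
    combines : ∀ d → combination s (λ k → (- l⁻¹) * ls (suc k)) (λ k → u (suc k)) d ≡ u zero d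
    combines d = begin
        Σ[< s ] (λ k → ((- l⁻¹) * ls (suc k)) * u (suc k) d)
          ≡⟨ trans (Σ-cong {s} (λ k → *-assoc _ _ _)) (sym (Σ-*ˡ (- l⁻¹) (λ k → ls (suc k) * u (suc k) d))) ⟩
        (- l⁻¹) * tail d
          ≡⟨ cong ((- l⁻¹) *_) (difference≡0 _ _ (trans (solve 2 (λ S y → S :+ :- (:- y) := y :+ S) refl (tail d) _) (relation d))) ⟩
        (- l⁻¹) * (- (ls zero * u zero d))
          ≡⟨ solve 3 (λ il l x → (:- il) :* (:- (l :* x)) := (il :* l) :* x) refl l⁻¹ (ls zero) (u zero d) ⟩
        (l⁻¹ * ls zero) * u zero d
          ≡⟨ trans (cong (_* u zero d) (inv-l (ls zero) head≢0)) (*-identityˡ _) ⟩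
        u zero d ∎
      where open ≡-Reasoning

  record Basis (m : ℕ) (v : Family m) : Set where
    field
      size            : ℕ
      index           : Fin size → Fin m
      index-injective : ∀ a b → index a ≡ index b → a ≡ b
      independent     : Independent size (λ k → v (index k))
      spanning        : ∀ i → InSpan size (λ k → v (index k)) (v i)

  -- Over a finitely enumerated domain, independence is decidable, so every
  -- finite family has a basis.
  module FiniteDomain {N : ℕ} (point : Fin N → D) (point-onto : ∀ d → Σ (Fin N) λ t → point t ≡ d) where

    -- Eliminate on the value vectors (u k (point t))_k: either they span K^r,
    -- which forces independence, or a functional kills them, which is a relation.
    independent-or-dependent : ∀ r (u : Family r) → Independent r u ⊎ Dependent r u
    independent-or-dependent r u with eliminate r N (λ t k → u k (point t))
    ... | inj₁ (ls , ls≢0 , ls⊥values) = inj₂ (ls , ls≢0 , relation)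
      where
      relation : ∀ d → combination r ls u d ≡ 0#
      relation d = subst (λ d → combination r ls u d ≡ 0#) (proj₂ (point-onto d)) (ls⊥values (proj₁ (point-onto d)))
    ... | inj₂ (_ , spans) = inj₁ independent
      where
      independent : Independent r u
      independent ls relation k = begin
          ls k                                                    ≡⟨ sym (Σ-δ k ls) ⟩
          Σ[< r ] (λ i → δ k i * ls i)                            ≡⟨ Σ-cong {r} (λ i → trans (*-comm _ _) (cong (ls i *_) (sym (proj₂ (spans (δ k)) i)))) ⟩
          Σ[< r ] (λ i → ls i * Σ[< N ] (λ t → μ t * u i (point t))) ≡⟨ Σ-exchange ls μ (λ i t → u i (point t)) ⟩
          Σ[< N ] (λ t → μ t * combination r ls u (point t))      ≡⟨ Σ-vanish {N} (λ t → trans (cong (μ t *_) (relation (point t))) (zeroʳ _)) ⟩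
          0#                                                      ∎
        where
        open ≡-Reasoning
        μ : Fin N → Carrier
        μ = proj₁ (spans (δ k))

    -- Greedy basis, built from the last member backwards: keep v zero exactly
    -- when it is independent of the basis of the tail.
    basis : ∀ m (v : Family m) → Basis m v
    basis zero    v = record { size = 0 ; index = λ () ; index-injective = λ () ; independent = λ _ _ () ; spanning = λ () }
    basis (suc m) v = extend (independent-or-dependent (suc size) (λ k → v (index⁺ k)))
      where
      open Basis (basis m (λ i → v (suc i)))
      index⁺ : Fin (suc size) → Fin (suc m)
      index⁺ zero    = zero
      index⁺ (suc k) = suc (index k)

      index⁺-injective : ∀ a b → index⁺ a ≡ index⁺ b → a ≡ b
      index⁺-injective zero    zero    _ = refl
      index⁺-injective (suc a) (suc b) e = cong suc (index-injective a b (FinP.suc-injective e))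

      extend : Independent (suc size) (λ k → v (index⁺ k)) ⊎ Dependent (suc size) (λ k → v (index⁺ k)) →
               Basis (suc m) v
      extend (inj₁ independent⁺) = record
        { size = suc size ; index = index⁺ ; index-injective = index⁺-injective
        ; independent = independent⁺ ; spanning = spanning⁺ }
        where
        spanning⁺ : ∀ i → InSpan (suc size) (λ k → v (index⁺ k)) (v i)
        spanning⁺ zero    = δ zero , λ d → Σ-δ zero (λ k → v (index⁺ k) d)
        spanning⁺ (suc i) = (λ { zero → 0# ; (suc k) → proj₁ (spanning i) k }) ,
          λ d → trans (cong (_+ combination size (proj₁ (spanning i)) (λ k → v (suc (index k))) d) (zeroˡ _))
                      (trans (+-identityˡ _) (proj₂ (spanning i) d))
      extend (inj₂ dependent⁺) = record
        { size = size ; index = λ k → suc (index k)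
        ; index-injective = λ a b e → index-injective a b (FinP.suc-injective e)
        ; independent = independent ; spanning = spanning⁺ }
        where
        spanning⁺ : ∀ i → InSpan size (λ k → v (suc (index k))) (v i)
        spanning⁺ zero    = dependent⇒head∈span size (λ k → v (index⁺ k)) independent dependent⁺
        spanning⁺ (suc i) = spanning i

    -- If r independent functions lie in the span of v, then some r members of
    -- v (at distinct indices) are independent: the basis of v spans the r
    -- functions, so it has at least r members, and its first r are independent.
    selectIndependent : ∀ r m (w : Family r) (v : Family m) → Independent r w →
      (∀ k → InSpan m v (w k)) →
      Σ (Fin r → Fin m) λ ρ → (∀ a b → ρ a ≡ ρ b → a ≡ b) × Independent r (λ k → v (ρ k))
    selectIndependent r m w v w-independent w∈span =
      (λ k → index (first k)) ,
      (λ a b e → first-injective a b (index-injective _ _ e)) ,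
      subfamily-independent r size (λ j → v (index j)) first first-injective independent
      where
      open Basis (basis m v)
      r≤size : r ℕ.≤ size
      r≤size = independent≤spanning r size w (λ j → v (index j)) w-independent
                 (λ k → InSpan-trans m size v (λ j → v (index j)) (w k) (w∈span k) spanning)
      first : Fin r → Fin size
      first k = Fin.inject≤ k r≤size
      first-injective : ∀ a b → first a ≡ first b → a ≡ b
      first-injective = FinP.inject≤-injective r≤size r≤size

module Polynomials {q n : ℕ} (K : FiniteField q n) where
  open FieldArithmetic K
  open Sums K

  eval : ∀ {k} → Vec Carrier k → Carrier → Carrier
  eval []       x = 0#
  eval (a ∷ as) x = a + x * eval as x

  eval-tabulate : ∀ {k} (f : Fin k → Carrier) x →
    eval (Vec.tabulate f) x ≡ Σ[< k ] (λ m → f m * pow x (toℕ m))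
  eval-tabulate {zero}  f x = refl
  eval-tabulate {suc k} f x = cong₂ _+_ (sym (*-identityʳ _)) (begin
      x * eval (Vec.tabulate (λ m → f (suc m))) x
        ≡⟨ cong (x *_) (eval-tabulate (λ m → f (suc m)) x) ⟩
      x * Σ[< k ] (λ m → f (suc m) * pow x (toℕ m))
        ≡⟨ Σ-*ˡ x (λ m → f (suc m) * pow x (toℕ m)) ⟩
      Σ[< k ] (λ m → x * (f (suc m) * pow x (toℕ m)))
        ≡⟨ Σ-cong {k} (λ m → solve 3 (λ x a b → x :* (a :* b) := a :* (x :* b)) refl x (f (suc m)) (pow x (toℕ m))) ⟩
      Σ[< k ] (λ m → f (suc m) * pow x (toℕ (suc m))) ∎)
    where open ≡-Reasoning

  -- synthetic division by x - p: quotient and remainder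
  divide : ∀ {d} → Carrier → Vec Carrier (suc d) → Vec Carrier d × Carrier
  divide p (a ∷ [])       = [] , a
  divide p (a ∷ (b ∷ bs)) = let (Q , r) = divide p (b ∷ bs) in (r ∷ Q) , a + p * r

  division : ∀ {d} p (a : Vec Carrier (suc d)) x →
    eval a x ≡ (x + - p) * eval (proj₁ (divide p a)) x + proj₂ (divide p a)
  division p (a ∷ [])       x = solve 3 (λ a x p → a :+ x :* :0 := (x :+ :- p) :* :0 :+ a) refl a x p
  division p (a ∷ (b ∷ bs)) x = begin
      a + x * eval (b ∷ bs) x  ≡⟨ cong (λ z → a + x * z) (division p (b ∷ bs) x) ⟩
      a + x * ((x + - p) * Q + r)
        ≡⟨ solve 5 (λ a x p Q r → a :+ x :* ((x :+ :- p) :* Q :+ r) := (x :+ :- p) :* (r :+ x :* Q) :+ (a :+ p :* r)) refl a x p Q r ⟩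
      (x + - p) * (r + x * Q) + (a + p * r) ∎
    where
    open ≡-Reasoning
    Q r : Carrier
    Q = eval (proj₁ (divide p (b ∷ bs))) x
    r = proj₂ (divide p (b ∷ bs))

  AllZero : ∀ {k} → Vec Carrier k → Set
  AllZero []       = ⊤
  AllZero (a ∷ as) = (a ≡ 0#) × AllZero as

  AllZero-lookup : ∀ {k} (v : Vec Carrier k) → AllZero v → ∀ i → Vec.lookup v i ≡ 0#
  AllZero-lookup (a ∷ as) (a≡0 , _)  zero    = a≡0
  AllZero-lookup (a ∷ as) (_ , as≡0) (suc i) = AllZero-lookup as as≡0 i

  division-zero : ∀ {d} p (a : Vec Carrier (suc d)) →
    AllZero (proj₁ (divide p a)) → proj₂ (divide p a) ≡ 0# → AllZero a
  division-zero p (a ∷ [])       _            r≡0 = r≡0 , tt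
  division-zero p (a ∷ (b ∷ bs)) (r'≡0 , Q≡0) r≡0 =
    trans (sym (trans (cong (λ z → a + p * z) r'≡0) (solve 2 (λ a p → a :+ p :* :0 := a) refl a p))) r≡0 ,
    division-zero p (b ∷ bs) Q≡0 r'≡0

  -- A polynomial of degree ≤ d vanishing at d + 1 distinct points is zero:
  -- dividing by x - p₀ leaves remainder 0 and a quotient vanishing at the others.
  roots : ∀ d (a : Vec Carrier (suc d)) (p : Fin (suc d) → Carrier) → (∀ i j → p i ≡ p j → i ≡ j) →
    (∀ k → eval a (p k) ≡ 0#) → AllZero a
  roots zero    (a ∷ []) p p-injective a-vanishes =
    trans (solve 2 (λ a x → a := a :+ x :* :0) refl a (p zero)) (a-vanishes zero) , tt
  roots (suc d) a p p-injective a-vanishes =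
    division-zero p₀ a (roots d Q (λ k → p (suc k)) (λ i j e → FinP.suc-injective (p-injective _ _ e)) Q-vanishes) R≡0
    where
    p₀ R : Carrier
    p₀ = p zero
    R = proj₂ (divide p₀ a)
    Q : Vec Carrier (suc d)
    Q = proj₁ (divide p₀ a)
    R≡0 : R ≡ 0#
    R≡0 = trans (solve 3 (λ x y R → R := (x :+ :- x) :* y :+ R) refl p₀ (eval Q p₀) R)
                (trans (sym (division p₀ a p₀)) (a-vanishes zero))
    Q-vanishes : ∀ k → eval Q (p (suc k)) ≡ 0#
    Q-vanishes k = cancel-nonzero (p (suc k) + - p₀) (eval Q (p (suc k)))
      (trans (sym (+-identityʳ _)) (trans (cong ((p (suc k) + - p₀) * eval Q (p (suc k)) +_) (sym R≡0))
             (trans (sym (division p₀ a (p (suc k)))) (a-vanishes (suc k)))))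
      (λ e → FinP.0≢1+n (p-injective _ _ (sym (difference≡0 _ _ e))))

-- Dedekind independence of the Frobenius powers x ↦ x^(q^i), i < n.

module Frobenius {q n : ℕ} (K : FiniteField q n) (q≥2 : 2 ℕ.≤ q) where
  open FieldArithmetic K
  open Sums K
  open Polynomials K

  instance
    q≢0 : ℕ.NonZero q
    q≢0 = ℕ.>-nonZero (ℕP.<-trans (ℕ.s≤s ℕ.z≤n) q≥2)

  d : ℕ
  d = ℕ.pred (q ℕ.^ n)

  1+d≡|K| : suc d ≡ q ℕ.^ n
  1+d≡|K| = ℕP.suc-pred (q ℕ.^ n) {{ℕP.m^n≢0 q n}}

  element : Fin (suc d) → Carrier
  element k = Inverse.from card (Fin.cast 1+d≡|K| k)

  element-injective : ∀ a b → element a ≡ element b → a ≡ b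
  element-injective a b e = FinP.toℕ-injective (begin
      toℕ a                        ≡⟨ sym (FinP.toℕ-cast 1+d≡|K| a) ⟩
      toℕ (Fin.cast 1+d≡|K| a)     ≡⟨ cong toℕ (sym (Inverse.strictlyInverseˡ card _)) ⟩
      toℕ (Inverse.to card (element a)) ≡⟨ cong (λ x → toℕ (Inverse.to card x)) e ⟩
      toℕ (Inverse.to card (element b)) ≡⟨ cong toℕ (Inverse.strictlyInverseˡ card _) ⟩
      toℕ (Fin.cast 1+d≡|K| b)     ≡⟨ FinP.toℕ-cast 1+d≡|K| b ⟩
      toℕ b                        ∎)
    where open ≡-Reasoning

  q^-injective : ∀ a b → q ℕ.^ a ≡ q ℕ.^ b → a ≡ b
  q^-injective a b e with ℕP.<-cmp a b
  ... | tri< a<b _ _ = ⊥-elim (ℕP.<⇒≢ (ℕP.^-monoʳ-< q q≥2 a<b) e)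
  ... | tri≈ _ a≡b _ = a≡b
  ... | tri> _ _ b<a = ⊥-elim (ℕP.<⇒≢ (ℕP.^-monoʳ-< q q≥2 b<a) (sym e))

  -- the Frobenius exponents are smaller than |K|, hence are degrees of
  -- polynomials with d + 1 coefficients
  q^i<1+d : (i : Fin n) → q ℕ.^ toℕ i ℕ.< suc d
  q^i<1+d i = subst (q ℕ.^ toℕ i ℕ.<_) (sym 1+d≡|K|) (ℕP.^-monoʳ-< q q≥2 (FinP.toℕ<n i))

  indicator : ℕ → ℕ → Carrier
  indicator a b = if a ℕ.≡ᵇ b then 1# else 0#

  indicator-sum : ∀ k (g : ℕ → Carrier) t → t ℕ.< k →
    Σ[< k ] (λ m → indicator (toℕ m) t * g (toℕ m)) ≡ g t
  indicator-sum (suc k) g zero    _ =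
    trans (cong₂ _+_ (*-identityˡ _) (Σ-vanish {k} (λ m → zeroˡ _))) (+-identityʳ _)
  indicator-sum (suc k) g (suc t) (ℕ.s≤s t<k) =
    trans (cong₂ _+_ (zeroˡ _) (indicator-sum k (λ a → g (suc a)) t t<k)) (+-identityˡ _)

  indicator-Frobenius : ∀ (i j : Fin n) → indicator (q ℕ.^ toℕ i) (q ℕ.^ toℕ j) ≡ δ i j
  indicator-Frobenius i j with i FinP.≟ j
  ... | yes refl = trans (indicator-refl (q ℕ.^ toℕ i)) (sym (δ-refl i))
    where
    indicator-refl : ∀ a → indicator a a ≡ 1#
    indicator-refl a with a ℕ.≡ᵇ a | ℕP.≡⇒≡ᵇ a a refl
    ... | true  | _  = refl
    ... | false | ()
  ... | no i≢j = trans indicator≡0 (sym (δ-≢ i j i≢j))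
    where
    a b : ℕ
    a = q ℕ.^ toℕ i
    b = q ℕ.^ toℕ j
    indicator≡0 : indicator a b ≡ 0#
    indicator≡0 with a ℕ.≡ᵇ b | ℕP.≡ᵇ⇒≡ a b
    ... | true  | a≡b = ⊥-elim (i≢j (FinP.toℕ-injective (q^-injective _ _ (a≡b tt))))
    ... | false | _   = refl

  -- If Σ_i ls_i x^(q^i) vanishes on all of K, then ls = 0: this is a
  -- polynomial of degree < |K| = d + 1 with |K| roots, whose coefficient
  -- at x^(q^i) is ls_i.
  frobenius-independent : (ls : Fin n → Carrier) →
    (∀ x → Σ[< n ] (λ i → ls i * frob (toℕ i) x) ≡ 0#) → ∀ i → ls i ≡ 0#
  frobenius-independent ls vanishes i = begin
      ls i                                    ≡⟨ sym (Σ-δ i ls) ⟩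
      Σ[< n ] (λ j → δ i j * ls j)            ≡⟨ Σ-cong {n} (λ j → trans (cong (_* ls j) (sym (indicator-Frobenius i j))) (*-comm _ _)) ⟩
      Σ[< n ] (λ j → ls j * indicator (q ℕ.^ toℕ i) (q ℕ.^ toℕ j))
        ≡⟨ cong (λ t → Σ[< n ] (λ j → ls j * indicator t (q ℕ.^ toℕ j))) (sym (FinP.toℕ-fromℕ< (q^i<1+d i))) ⟩
      coefficient degree                      ≡⟨ sym (VecP.lookup∘tabulate coefficient degree) ⟩
      Vec.lookup (Vec.tabulate coefficient) degree
        ≡⟨ AllZero-lookup _ (roots d (Vec.tabulate coefficient) element element-injective (λ k → polynomial-vanishes (element k))) degree ⟩
      0#                                      ∎
    where
    open ≡-Reasoning
    degree : Fin (suc d)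
    degree = Fin.fromℕ< (q^i<1+d i)
    coefficient : Fin (suc d) → Carrier
    coefficient m = Σ[< n ] (λ j → ls j * indicator (toℕ m) (q ℕ.^ toℕ j))
    polynomial-vanishes : ∀ x → eval (Vec.tabulate coefficient) x ≡ 0#
    polynomial-vanishes x = begin
        eval (Vec.tabulate coefficient) x
          ≡⟨ eval-tabulate coefficient x ⟩
        Σ[< suc d ] (λ m → coefficient m * pow x (toℕ m))
          ≡⟨ Σ-cong {suc d} (λ m → trans (Σ-*ʳ (pow x (toℕ m)) (λ j → ls j * indicator (toℕ m) (q ℕ.^ toℕ j)))
                                         (Σ-cong {n} (λ j → *-assoc _ _ _))) ⟩
        Σ[< suc d ] (λ m → Σ[< n ] (λ j → ls j * (indicator (toℕ m) (q ℕ.^ toℕ j) * pow x (toℕ m))))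
          ≡⟨ Σ-swap {suc d} {n} (λ m j → ls j * (indicator (toℕ m) (q ℕ.^ toℕ j) * pow x (toℕ m))) ⟩
        Σ[< n ] (λ j → Σ[< suc d ] (λ m → ls j * (indicator (toℕ m) (q ℕ.^ toℕ j) * pow x (toℕ m))))
          ≡⟨ Σ-cong {n} (λ j → trans (sym (Σ-*ˡ {suc d} (ls j) (λ m → indicator (toℕ m) (q ℕ.^ toℕ j) * pow x (toℕ m))))
                                     (cong (ls j *_) (indicator-sum (suc d) (pow x) _ (q^i<1+d j)))) ⟩
        Σ[< n ] (λ j → ls j * frob (toℕ j) x)
          ≡⟨ vanishes x ⟩
        0# ∎

-- Independent rows of M(S) correspond to independent slices of S.

module RankBySlices {q n : ℕ} (K : FiniteField q n) (q≥2 : 2 ℕ.≤ q) where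
  open FieldArithmetic K
  open Sums K
  open Elimination K
  open Families K {Carrier}
  open Frobenius K q≥2 using (frobenius-independent)

  N : ℕ
  N = q ℕ.^ n

  point : Fin N → Carrier
  point = Inverse.from card

  point-onto : ∀ x → Σ (Fin N) λ t → point t ≡ x
  point-onto x = Inverse.to card x , Inverse.strictlyInverseʳ card x

  open FiniteDomain point point-onto using (selectIndependent)

  linearised : (Fin n → Carrier) → Carrier → Carrier
  linearised a y = Σ[< n ] (λ j → a j * frob (toℕ j) y)

  combination-linearised : ∀ r ls (v : Fin r → Fin n → Carrier) y →
    combination r ls (λ k → linearised (v k)) y ≡ linearised (λ j → Σ[< r ] (λ k → ls k * v k j)) y
  combination-linearised r ls v y = begin
      Σ[< r ] (λ k → ls k * Σ[< n ] (λ j → v k j * frob (toℕ j) y))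
        ≡⟨ Σ-cong {r} (λ k → cong (ls k *_) (Σ-cong {n} (λ j → *-comm _ _))) ⟩
      Σ[< r ] (λ k → ls k * Σ[< n ] (λ j → frob (toℕ j) y * v k j))
        ≡⟨ Σ-exchange ls (λ j → frob (toℕ j) y) v ⟩
      Σ[< n ] (λ j → frob (toℕ j) y * Σ[< r ] (λ k → ls k * v k j))
        ≡⟨ Σ-cong {n} (λ j → *-comm _ _) ⟩
      Σ[< n ] (λ j → Σ[< r ] (λ k → ls k * v k j) * frob (toℕ j) y) ∎
    where open ≡-Reasoning

  -- Coefficient vectors are independent iff their linearised polynomials are
  -- (the nontrivial direction is the independence of the Frobenius powers).
  linearised-independent⇒LinIndep : ∀ r (v : Fin r → Fin n → Carrier) →
    Independent r (λ k → linearised (v k)) → LinIndep r v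
  linearised-independent⇒LinIndep r v independent ls ls⊥v = independent ls λ y →
    trans (combination-linearised r ls v y) (Σ-vanish {n} (λ j → trans (cong (_* frob (toℕ j) y) (ls⊥v j)) (zeroˡ _)))

  LinIndep⇒linearised-independent : ∀ r (v : Fin r → Fin n → Carrier) →
    LinIndep r v → Independent r (λ k → linearised (v k))
  LinIndep⇒linearised-independent r v independent ls relation = independent ls
    (frobenius-independent (λ j → Σ[< r ] (λ k → ls k * v k j))
      (λ y → trans (sym (combination-linearised r ls v y)) (relation y)))

  mult-by-rows : ∀ c x y → mult c x y ≡ Σ[< n ] (λ i → frob (toℕ i) x * linearised (c i) y)
  mult-by-rows c x y = Σ-cong {n} (λ i → trans
    (Σ-cong {n} (λ j → solve 3 (λ a b z → (a :* b) :* z := b :* (a :* z)) refl (c i j) (frob (toℕ i) x) (frob (toℕ j) y)))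
    (sym (Σ-*ˡ (frob (toℕ i) x) (λ j → c i j * frob (toℕ j) y))))

  slice∈rows : ∀ c x → InSpan n (λ i → linearised (c i)) (mult c x)
  slice∈rows c x = (λ i → frob (toℕ i) x) , λ y → sym (mult-by-rows c x y)

  -- the vectors (t^(q^j))_j, t ∈ K, span K^n: a functional killing them all
  -- would be a vanishing combination of Frobenius powers
  frobenius-vectors-span : Spans n N (λ t j → frob (toℕ j) (point t))
  frobenius-vectors-span with eliminate n N (λ t j → frob (toℕ j) (point t))
  ... | inj₂ (_ , spans) = spans
  ... | inj₁ (ls , (k , lsk≢0) , ls⊥vectors) = ⊥-elim (lsk≢0 (frobenius-independent ls vanishes k))
    where
    vanishes : ∀ x → Σ[< n ] (λ j → ls j * frob (toℕ j) x) ≡ 0#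
    vanishes x = subst (λ x → Σ[< n ] (λ j → ls j * frob (toℕ j) x) ≡ 0#) (proj₂ (point-onto x)) (ls⊥vectors (proj₁ (point-onto x)))

  -- conversely every row polynomial L_i is a combination of slices: choose
  -- coefficients μ_t with Σ_t μ_t t^(q^j) = δ_ij
  row∈slices : ∀ c i → InSpan N (λ t → mult c (point t)) (linearised (c i))
  row∈slices c i = μ , λ y → begin
      Σ[< N ] (λ t → μ t * mult c (point t) y)
        ≡⟨ Σ-cong {N} (λ t → cong (μ t *_) (trans (mult-by-rows c (point t) y) (Σ-cong {n} (λ j → *-comm _ _)))) ⟩
      Σ[< N ] (λ t → μ t * Σ[< n ] (λ j → linearised (c j) y * frob (toℕ j) (point t)))
        ≡⟨ Σ-exchange μ (λ j → linearised (c j) y) (λ t j → frob (toℕ j) (point t)) ⟩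
      Σ[< n ] (λ j → linearised (c j) y * Σ[< N ] (λ t → μ t * frob (toℕ j) (point t)))
        ≡⟨ Σ-cong {n} (λ j → trans (cong (linearised (c j) y *_) (proj₂ (frobenius-vectors-span (δ i)) j)) (*-comm _ _)) ⟩
      Σ[< n ] (λ j → δ i j * linearised (c j) y)
        ≡⟨ Σ-δ i (λ j → linearised (c j) y) ⟩
      linearised (c i) y ∎
    where
    open ≡-Reasoning
    μ : Fin N → Carrier
    μ = proj₁ (frobenius-vectors-span (δ i))

  IndependentSlices : Matrix → ℕ → Set
  IndependentSlices c r = Σ (Fin r → Carrier) λ x → Independent r (λ k → mult c (x k))

  -- The two characterisations agree: each family spans the other, so
  -- independence passes by selecting an independent subfamily.
  slices⇒rows : ∀ c r → IndependentSlices c r → HasIndepRows c r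
  slices⇒rows c r (x , independent) =
    let (ρ , ρ-injective , rows-independent) =
          selectIndependent r n (λ k → mult c (x k)) (λ i → linearised (c i)) independent (λ k → slice∈rows c (x k))
    in ρ , ρ-injective , linearised-independent⇒LinIndep r (λ k → c (ρ k)) rows-independent

  rows⇒slices : ∀ c r → HasIndepRows c r → IndependentSlices c r
  rows⇒slices c r (ρ , _ , rows-independent) =
    let (τ , _ , slices-independent) =
          selectIndependent r N (λ k → linearised (c (ρ k))) (λ t → mult c (point t))
            (LinIndep⇒linearised-independent r (λ k → c (ρ k)) rows-independent) (λ k → row∈slices c (ρ k))
    in (λ k → point (τ k)) , slices-independent

  Substitution : Matrix → Matrix → Set
  Substitution c c' = Σ (Carrier → Carrier) λ F → Σ (Carrier → Carrier) λ G → ∀ x y → mult c' (F x) (G y) ≡ mult c x y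

  -- independent slices of c at x_k give independent slices of c' at F x_k:
  -- a relation among the latter restricts, along G, to one among the former
  slices-transport : ∀ c c' r → Substitution c c' → IndependentSlices c r → IndependentSlices c' r
  slices-transport c c' r (F , G , substitution) (x , independent) =
    (λ k → F (x k)) , λ ls relation → independent ls λ y →
      trans (Σ-cong {r} (λ k → cong (ls k *_) (sym (substitution (x k) y)))) (relation (G y))

  isotopy⇒substitution : ∀ c c' → StronglyIsotopic c c' → Substitution c c'
  isotopy⇒substitution c c' (F , G , _ , _ , isotopy) = F , G , isotopy

  isotopy⇒substitution⁻¹ : ∀ c c' → StronglyIsotopic c c' → Substitution c' c
  isotopy⇒substitution⁻¹ c c' (F , G , (_ , _ , F⁻¹ , _ , F∘F⁻¹) , (_ , _ , G⁻¹ , _ , G∘G⁻¹) , isotopy) =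
    F⁻¹ , G⁻¹ , λ x y → begin
      mult c (F⁻¹ x) (G⁻¹ y)              ≡⟨ sym (isotopy (F⁻¹ x) (G⁻¹ y)) ⟩
      mult c' (F (F⁻¹ x)) (G (G⁻¹ y))     ≡⟨ cong₂ (mult c') (F∘F⁻¹ x) (G∘G⁻¹ y) ⟩
      mult c' x y                         ∎
    where open ≡-Reasoning

  indepRows-invariant : ∀ c c' → StronglyIsotopic c c' → ∀ r → HasIndepRows c r ⇔ HasIndepRows c' r
  indepRows-invariant c c' isotopic r = mk⇔
    (λ rows → slices⇒rows c' r (slices-transport c c' r (isotopy⇒substitution c c' isotopic) (rows⇒slices c r rows)))
    (λ rows → slices⇒rows c r (slices-transport c' c r (isotopy⇒substitution⁻¹ c c' isotopic) (rows⇒slices c' r rows)))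

HasRank-cong : ∀ {q n} (K : FiniteField q n) → let open FiniteField K in ∀ (c c' : Matrix) →
  (∀ r → HasIndepRows c r ⇔ HasIndepRows c' r) → ∀ r → HasRank c r ⇔ HasRank c' r
HasRank-cong K c c' rows⇔ r = mk⇔
  (λ (rows , ¬rows⁺) → Equivalence.to (rows⇔ r) rows , λ rows⁺ → ¬rows⁺ (Equivalence.from (rows⇔ (suc r)) rows⁺))
  (λ (rows , ¬rows⁺) → Equivalence.from (rows⇔ r) rows , λ rows⁺ → ¬rows⁺ (Equivalence.to (rows⇔ (suc r)) rows⁺))

-- Theorem: strongly isotopic semifields have the same matrix rank.

mainTheorem7 : (q n : ℕ) → 2 ℕ.≤ q → 1 ℕ.≤ n → (K : FiniteField q n) →
    let open FiniteField K in
    (c c' : Matrix) → IsSemifield c → IsSemifield c' → StronglyIsotopic c c' →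
    (r : ℕ) → HasRank c r ⇔ HasRank c' r
mainTheorem7 q n q≥2 _ K c c' _ _ isotopic =
  HasRank-cong K c c' (indepRows-invariant c c' isotopic)
  where open RankBySlices K q≥2
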